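{- Let $S$ be a finite $0$-rectangular band whose nonzero $\mathscr{D}$-class has $m$ rows and $n=am$ columns, where $a$ is a positive integer. If $S$ has a permutation matching, then $S$ has an involution matching. -}

module Defs where

open import Data.Nat using (ℕ)
open import Data.Fin using (Fin)
open import Data.Bool using (Bool; true; if_then_else_)
open import Data.Product using (Σ; ∃; _×_)
open import Relation.Binary.PropositionalEquality using (_≡_)
open import Function.Definitions using (Bijective)

module _ {A : Set} (_·_ : A → A → A) where

  IsInverseOf : A → A → Set
  IsInverseOf y x = ((x · y) · x ≡ x) × ((y · x) · y ≡ y)

  PermutationMatching : Set
  PermutationMatching =
    Σ (A → A) λ f → Bijective _≡_ _≡_ f × (∀ x → IsInverseOf (f x) x)

  InvolutionMatching : Set
  InvolutionMatching =
    Σ (A → A) λ f → (∀ x → f (f x) ≡ x) × (∀ x → IsInverseOf (f x) x)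

-- 0-rectangular band M⁰[{1}; I, Λ; P] with I = Fin m (rows),
-- Λ = Fin n (columns), sandwich matrix P : Λ × I → {0,1}.

data ZRB (m n : ℕ) : Set where
  𝟎  : ZRB m n
  el : Fin m → Fin n → ZRB m n

mul : {m n : ℕ} → (Fin n → Fin m → Bool) → ZRB m n → ZRB m n → ZRB m n
mul P 𝟎 _ = 𝟎
mul P (el i l) 𝟎 = 𝟎
mul P (el i l) (el j μ) = if P l j then el i μ else 𝟎

RegularMatrix : {m n : ℕ} → (Fin n → Fin m → Bool) → Set
RegularMatrix {m} {n} P =
  (∀ (λ′ : Fin n) → ∃ λ (i : Fin m) → P λ′ i ≡ true) ×
  (∀ (i : Fin m) → ∃ λ (λ′ : Fin n) → P λ′ i ≡ true)

-- Split the n = a * m columns into slots (c , i), a of them reserved for each row i.  A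
-- permutation matching f sends the ∣ I ∣ * n nonzero elements in the rows of a set I
-- injectively to elements whose column meets (has sandwich entry 1 with) a row of I; so at
-- least a * ∣ I ∣ columns meet I, which is Hall's condition for matching every slot (c , i)
-- to a distinct column meeting row i.  Hall's theorem gives a bijection σ from slots to
-- columns with σ (c , i) meeting row i, and then (i , σ (c , j)) ↦ (j , σ (c , i)) is an
-- involution sending each element of the 0-rectangular band to one of its inverses.
module Submission where

open import Defs
open import Data.Bool.Base using (Bool; true; false)
import Data.Bool.Properties as Bool
open import Data.Fin.Base using (Fin; zero; suc; punchOut; combine; remQuot)
open import Data.Fin.Properties
  using ( _≟_; any?; suc-injective; injective⇒≤; punchOut-injective
        ; remQuot-combine; combine-remQuot; *↔× )
open import Data.Fin.Subset
  using ( Subset; inside; outside; _∈_; _∉_; _⊆_; _⊂_; _∩_; _∪_; _─_; _-_; ⁅_⁆; ⊤; ∣_∣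
        ; Nonempty; Empty )
open import Data.Fin.Subset.Properties
  using ( _∈?_; _⊂?_; nonempty?; anySubset?; Empty-unique; ∣⊥∣≡0; ∈⊤; ∩-identityʳ
        ; ⊆-trans; ⊆-⊂-trans; p⊂q⇒p⊆q; p∩q≢∅⇒p─q⊂p; x∈p⇒p-x⊂p; p⊆q⇒∣p∣≤∣q∣
        ; x∈p∩q⁺; x∈p∩q⁻; x∈p∪q⁺; x∈p∪q⁻; x∈p∧x∉q⇒x∈p─q; p─q⊆p; x∈p∧x≢y⇒x∈p-y
        ; x∈⁅x⁆; x∈⁅y⁆⇒x≡y; ∣⁅x⁆∣≡1 )
open import Data.Fin.Subset.Induction using (Acc; acc; ⊂-wellFounded)
open import Data.List.Base using (List; []; _∷_; map; length; _++_; cartesianProduct; allFin)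
open import Data.List.Properties using (length-map; length-++; length-++-sucʳ; length-tabulate)
open import Data.List.Membership.Propositional using () renaming (_∈_ to _∈ₗ_)
open import Data.List.Membership.Propositional.Properties
  using ( ∈-map⁺; ∈-map⁻; ∈-∃++; ∈-++⁻; ∈-++⁺ˡ; ∈-++⁺ʳ; ∈-allFin
        ; ∈-cartesianProduct⁺; ∈-cartesianProduct⁻ )
open import Data.List.Relation.Binary.Subset.Propositional using () renaming (_⊆_ to _⊆ₗ_)
import Data.List.Relation.Unary.All as All
open import Data.List.Relation.Unary.AllPairs using ([]; _∷_)
open import Data.List.Relation.Unary.Any as Any using ()
open import Data.List.Relation.Unary.Unique.Propositional using (Unique)
import Data.List.Relation.Unary.Unique.Propositional.Properties as Unique
open import Data.Nat.Base using (ℕ; zero; suc; _+_; _*_; _≤_; _<_; z≤n; s≤s; NonZero)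
open import Data.Nat.Properties
  using ( module ≤-Reasoning; _≤?_; ≤-trans; ≰⇒>; +-suc; +-identityʳ; +-comm; +-monoʳ-≤
        ; +-cancelʳ-≤; <-irrefl; m≤m+n; *-comm; *-assoc; *-cancelʳ-≤; 1+n≰n )
open import Data.Product using (Σ; ∃; ∃₂; _×_; _,_; proj₁; proj₂; uncurry)
open import Data.Sum using (inj₁; inj₂)
open import Data.Vec.Base using ([]; _∷_; here; there; tabulate)
open import Data.Vec.Properties using (lookup∘tabulate; []=⇒lookup; lookup⇒[]=)
open import Function.Base using (_∘_)
open import Function.Bundles using (_↔_; Inverse; mk↔ₛ′)
open import Function.Construct.Composition using (_↔-∘_)
open import Function.Construct.Symmetry using (↔-sym)
open import Function.Definitions using (Injective; StrictlySurjective)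
open import Relation.Nullary using (Dec; yes; no; does; contradiction)
open import Relation.Nullary.Decidable using (dec-true; _×-dec_)
open import Relation.Binary.PropositionalEquality
  using (_≡_; _≢_; refl; sym; trans; cong; cong₂; subst; module ≡-Reasoning)

select : ∀ {n} {P : Fin n → Set} → (∀ x → Dec (P x)) → Subset n
select P? = tabulate (λ x → does (P? x))

module _ {n} {P : Fin n → Set} (P? : ∀ x → Dec (P x)) {x : Fin n} where

  ∈-select⁺ : P x → x ∈ select P?
  ∈-select⁺ px = lookup⇒[]= x _ (trans (lookup∘tabulate _ x) (dec-true (P? x) px))

  ∈-select⁻ : x ∈ select P? → P x
  ∈-select⁻ x∈ with P? x | trans (sym (lookup∘tabulate _ x)) ([]=⇒lookup x∈)
  ... | yes px | _ = px

module _ {k l} {E : Fin k → Fin l → Set} (E? : ∀ x y → Dec (E x y)) where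

  adjacent? : ∀ A y → Dec (∃ λ x → x ∈ A × E x y)
  adjacent? A y = any? (λ x → x ∈? A ×-dec E? x y)

  neighbours : Subset k → Subset l
  neighbours A = select (adjacent? A)

  ∈-neighbours⁺ : ∀ {A x y} → x ∈ A → E x y → y ∈ neighbours A
  ∈-neighbours⁺ {A} x∈A e = ∈-select⁺ (adjacent? A) (_ , x∈A , e)

  ∈-neighbours⁻ : ∀ {A y} → y ∈ neighbours A → ∃ λ x → x ∈ A × E x y
  ∈-neighbours⁻ {A} = ∈-select⁻ (adjacent? A)

  neighbours-mono : ∀ {A B} → A ⊆ B → neighbours A ⊆ neighbours B
  neighbours-mono A⊆B y∈ with x , x∈A , e ← ∈-neighbours⁻ y∈ = ∈-neighbours⁺ (A⊆B x∈A) e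

  neighbours-∪ : ∀ A B → neighbours (A ∪ B) ⊆ neighbours A ∪ neighbours B
  neighbours-∪ A B y∈ with x , x∈A∪B , e ← ∈-neighbours⁻ y∈ with x∈p∪q⁻ A B x∈A∪B
  ... | inj₁ x∈A = x∈p∪q⁺ (inj₁ (∈-neighbours⁺ x∈A e))
  ... | inj₂ x∈B = x∈p∪q⁺ (inj₂ (∈-neighbours⁺ x∈B e))

neighbours-∘ : ∀ {k l o} {E : Fin k → Fin l → Set} {F : Fin l → Fin o → Set} {G : Fin k → Fin o → Set}
               (E? : ∀ x y → Dec (E x y)) (F? : ∀ y z → Dec (F y z)) (G? : ∀ x z → Dec (G x z)) →
               (∀ {x y z} → E x y → F y z → G x z) →
               ∀ A → neighbours F? (neighbours E? A) ⊆ neighbours G? A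
neighbours-∘ E? F? G? compose A z∈
  with y , y∈ , f ← ∈-neighbours⁻ F? z∈
  with x , x∈A , e ← ∈-neighbours⁻ E? y∈ = ∈-neighbours⁺ G? x∈A (compose e f)

∣p∪q∣+∣p∩q∣≡∣p∣+∣q∣ : ∀ {n} (p q : Subset n) → ∣ p ∪ q ∣ + ∣ p ∩ q ∣ ≡ ∣ p ∣ + ∣ q ∣
∣p∪q∣+∣p∩q∣≡∣p∣+∣q∣ []            []            = refl
∣p∪q∣+∣p∩q∣≡∣p∣+∣q∣ (inside ∷ p)  (inside ∷ q)  =
  cong suc (trans (+-suc _ _) (trans (cong suc (∣p∪q∣+∣p∩q∣≡∣p∣+∣q∣ p q)) (sym (+-suc _ _))))
∣p∪q∣+∣p∩q∣≡∣p∣+∣q∣ (inside ∷ p)  (outside ∷ q) = cong suc (∣p∪q∣+∣p∩q∣≡∣p∣+∣q∣ p q)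
∣p∪q∣+∣p∩q∣≡∣p∣+∣q∣ (outside ∷ p) (inside ∷ q)  = trans (cong suc (∣p∪q∣+∣p∩q∣≡∣p∣+∣q∣ p q)) (sym (+-suc _ _))
∣p∪q∣+∣p∩q∣≡∣p∣+∣q∣ (outside ∷ p) (outside ∷ q) = ∣p∪q∣+∣p∩q∣≡∣p∣+∣q∣ p q

∣p∪q∣≤∣p∣+∣q∣ : ∀ {n} (p q : Subset n) → ∣ p ∪ q ∣ ≤ ∣ p ∣ + ∣ q ∣
∣p∪q∣≤∣p∣+∣q∣ p q = subst (∣ p ∪ q ∣ ≤_) (∣p∪q∣+∣p∩q∣≡∣p∣+∣q∣ p q) (m≤m+n _ _)

Empty⇒∣p∣≡0 : ∀ {n} {p : Subset n} → Empty p → ∣ p ∣ ≡ 0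
Empty⇒∣p∣≡0 {n} p-empty = trans (cong ∣_∣ (Empty-unique p-empty)) (∣⊥∣≡0 n)

0<∣p∣⇒Nonempty : ∀ {n} {p : Subset n} → 0 < ∣ p ∣ → Nonempty p
0<∣p∣⇒Nonempty {p = p} 0<∣p∣ with nonempty? p
... | yes p≠∅ = p≠∅
... | no  p=∅ = contradiction (sym (Empty⇒∣p∣≡0 p=∅)) (λ eq → <-irrefl eq 0<∣p∣)

disjoint⇒∣p∪q∣≡∣p∣+∣q∣ : ∀ {n} (p q : Subset n) → Empty (p ∩ q) → ∣ p ∪ q ∣ ≡ ∣ p ∣ + ∣ q ∣
disjoint⇒∣p∪q∣≡∣p∣+∣q∣ p q p∩q=∅ = begin
  ∣ p ∪ q ∣             ≡⟨ sym (+-identityʳ _) ⟩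
  ∣ p ∪ q ∣ + 0         ≡⟨ cong (∣ p ∪ q ∣ +_) (sym (Empty⇒∣p∣≡0 p∩q=∅)) ⟩
  ∣ p ∪ q ∣ + ∣ p ∩ q ∣ ≡⟨ ∣p∪q∣+∣p∩q∣≡∣p∣+∣q∣ p q ⟩
  ∣ p ∣ + ∣ q ∣         ∎
  where open ≡-Reasoning

x∈p─q⇒x∉q : ∀ {n} {p q : Subset n} {x} → x ∈ p ─ q → x ∉ q
x∈p─q⇒x∉q {p = _ ∷ p} {q = _ ∷ q} (there x∈p─q) (there x∈q) = x∈p─q⇒x∉q {p = p} x∈p─q x∈q

x∈p⇒⁅x⁆⊆p : ∀ {n} {p : Subset n} {x} → x ∈ p → ⁅ x ⁆ ⊆ p
x∈p⇒⁅x⁆⊆p {p = p} {x} x∈p y∈⁅x⁆ = subst (_∈ p) (sym (x∈⁅y⁆⇒x≡y x y∈⁅x⁆)) x∈p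

unique⊆⇒length≤ : ∀ {A : Set} {xs ys : List A} → Unique xs → xs ⊆ₗ ys → length xs ≤ length ys
unique⊆⇒length≤ {xs = []} [] _ = z≤n
unique⊆⇒length≤ {xs = x ∷ xs} (x∉xs ∷ xs!) xs⊆ys
  with ys₁ , ys₂ , refl ← ∈-∃++ (xs⊆ys (Any.here refl)) =
  subst (suc (length xs) ≤_) (sym (length-++-sucʳ ys₁ x ys₂)) (s≤s (unique⊆⇒length≤ xs! xs⊆ys₁++ys₂))
  where
  xs⊆ys₁++ys₂ : xs ⊆ₗ ys₁ ++ ys₂
  xs⊆ys₁++ys₂ {z} z∈xs with ∈-++⁻ ys₁ (xs⊆ys (Any.there z∈xs))
  ... | inj₁ z∈ys₁ = ∈-++⁺ˡ z∈ys₁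
  ... | inj₂ (Any.here z≡x) = contradiction (sym z≡x) (All.lookup x∉xs z∈xs)
  ... | inj₂ (Any.there z∈ys₂) = ∈-++⁺ʳ ys₁ z∈ys₂

length-cartesianProduct : ∀ {A B : Set} (xs : List A) (ys : List B) →
                          length (cartesianProduct xs ys) ≡ length xs * length ys
length-cartesianProduct []       ys = refl
length-cartesianProduct (x ∷ xs) ys = begin
  length (map (x ,_) ys ++ cartesianProduct xs ys)          ≡⟨ length-++ (map (x ,_) ys) ⟩
  length (map (x ,_) ys) + length (cartesianProduct xs ys)  ≡⟨ cong₂ _+_ (length-map (x ,_) ys) (length-cartesianProduct xs ys) ⟩
  length ys + length xs * length ys                         ∎
  where open ≡-Reasoning

length-allFin : ∀ n → length (allFin n) ≡ n
length-allFin n = length-tabulate (λ x → x)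

elements : ∀ {n} → Subset n → List (Fin n)
elements []            = []
elements (inside  ∷ p) = zero ∷ map suc (elements p)
elements (outside ∷ p) = map suc (elements p)

length-elements : ∀ {n} (p : Subset n) → length (elements p) ≡ ∣ p ∣
length-elements []            = refl
length-elements (inside  ∷ p) = cong suc (trans (length-map suc (elements p)) (length-elements p))
length-elements (outside ∷ p) = trans (length-map suc (elements p)) (length-elements p)

∈-elements⁺ : ∀ {n} {p : Subset n} {x} → x ∈ p → x ∈ₗ elements p
∈-elements⁺ {p = inside  ∷ p} here          = Any.here refl
∈-elements⁺ {p = inside  ∷ p} (there x∈p)   = Any.there (∈-map⁺ suc (∈-elements⁺ x∈p))
∈-elements⁺ {p = outside ∷ p} (there x∈p)   = ∈-map⁺ suc (∈-elements⁺ x∈p)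

∈-elements⁻ : ∀ {n} (p : Subset n) {x} → x ∈ₗ elements p → x ∈ p
∈-elements⁻ (inside  ∷ p) (Any.here refl) = here
∈-elements⁻ (inside  ∷ p) (Any.there x∈)  with y , y∈ , refl ← ∈-map⁻ suc x∈ = there (∈-elements⁻ p y∈)
∈-elements⁻ (outside ∷ p) x∈              with y , y∈ , refl ← ∈-map⁻ suc x∈ = there (∈-elements⁻ p y∈)

elements-unique : ∀ {n} (p : Subset n) → Unique (elements p)
elements-unique []            = []
elements-unique (inside  ∷ p) =
  All.tabulate zero∉ ∷ Unique.map⁺ suc-injective (elements-unique p)
  where
  zero∉ : ∀ {y} → y ∈ₗ map suc (elements p) → zero ≢ y
  zero∉ y∈ with _ , _ , refl ← ∈-map⁻ suc y∈ = λ ()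
elements-unique (outside ∷ p) = Unique.map⁺ suc-injective (elements-unique p)

injective-map⇒length≤ : ∀ {A B : Set} (g : A → B) → (∀ {x y} → g x ≡ g y → x ≡ y) →
                        ∀ {xs ys} → Unique xs → (∀ {x} → x ∈ₗ xs → g x ∈ₗ ys) → length xs ≤ length ys
injective-map⇒length≤ g g-inj {xs} {ys} xs! g[xs]⊆ys =
  subst (_≤ length ys) (length-map g xs) (unique⊆⇒length≤ (Unique.map⁺ g-inj xs!) map-g⊆ys)
  where
  map-g⊆ys : map g xs ⊆ₗ ys
  map-g⊆ys y∈ with x , x∈xs , refl ← ∈-map⁻ g y∈ = g[xs]⊆ys x∈xs

Fin-injective⇒strictlySurjective : ∀ {n} {f : Fin n → Fin n} → Injective _≡_ _≡_ f → StrictlySurjective _≡_ f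
Fin-injective⇒strictlySurjective {suc n} {f} f-inj y with any? (λ x → f x ≟ y)
... | yes hit  = hit
... | no  miss = contradiction (injective⇒≤ f′-injective) (1+n≰n {n})
  where
  y≢f : ∀ x → y ≢ f x
  y≢f x y≡fx = miss (x , sym y≡fx)

  f′ : Fin (suc n) → Fin n
  f′ x = punchOut (y≢f x)

  f′-injective : Injective _≡_ _≡_ f′
  f′-injective eq = f-inj (punchOut-injective (y≢f _) (y≢f _) eq)

Fin-injective⇒↔ : ∀ {n} {f : Fin n → Fin n} → Injective _≡_ _≡_ f → Fin n ↔ Fin n
Fin-injective⇒↔ {f = f} f-inj = mk↔ₛ′ f (proj₁ ∘ surj) (proj₂ ∘ surj) (λ x → f-inj (proj₂ (surj (f x))))
  where
  surj : StrictlySurjective _≡_ f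
  surj = Fin-injective⇒strictlySurjective f-inj

module Hall {k l} {E : Fin k → Fin l → Set} (E? : ∀ x y → Dec (E x y)) where

  private
    N : Subset k → Subset l
    N = neighbours E?

  HallCondition : Subset k → Subset l → Set
  HallCondition L R = ∀ {A} → A ⊆ L → ∣ A ∣ ≤ ∣ N A ∩ R ∣

  record Matching (L : Subset k) (R : Subset l) : Set where
    field
      match           : ∀ {x} → x ∈ L → Fin l
      match-∈         : ∀ {x} (x∈L : x ∈ L) → match x∈L ∈ R
      match-edge      : ∀ {x} (x∈L : x ∈ L) → E x (match x∈L)
      match-injective : ∀ {x y} (x∈L : x ∈ L) (y∈L : y ∈ L) → match x∈L ≡ match y∈L → x ≡ y

  empty-matching : ∀ {L R} → Empty L → Matching L R
  empty-matching L=∅ = record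
    { match           = λ x∈L → contradiction (_ , x∈L) L=∅
    ; match-∈         = λ x∈L → contradiction (_ , x∈L) L=∅
    ; match-edge      = λ x∈L → contradiction (_ , x∈L) L=∅
    ; match-injective = λ x∈L _ _ → contradiction (_ , x∈L) L=∅
    }

  singleton-matching : ∀ {x y R} → y ∈ R → E x y → Matching ⁅ x ⁆ (⁅ y ⁆ ∩ R)
  singleton-matching {x} {y} y∈R e = record
    { match           = λ _ → y
    ; match-∈         = λ _ → x∈p∩q⁺ (x∈⁅x⁆ y , y∈R)
    ; match-edge      = λ x′∈ → subst (λ x′ → E x′ y) (sym (x∈⁅y⁆⇒x≡y x x′∈)) e
    ; match-injective = λ x₁∈ x₂∈ _ → trans (x∈⁅y⁆⇒x≡y x x₁∈) (sym (x∈⁅y⁆⇒x≡y x x₂∈))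
    }

  split-matching : ∀ {L R A Q} → A ⊆ L → Matching A (Q ∩ R) → Matching (L ─ A) (R ─ Q) → Matching L R
  split-matching {L} {R} {A} {Q} A⊆L M₁ M₂ = record
    { match = match ; match-∈ = match-∈ ; match-edge = match-edge ; match-injective = match-injective }
    where
    module M₁ = Matching M₁
    module M₂ = Matching M₂

    match : ∀ {x} → x ∈ L → Fin l
    match {x} x∈L with x ∈? A
    ... | yes x∈A = M₁.match x∈A
    ... | no  x∉A = M₂.match (x∈p∧x∉q⇒x∈p─q x∈L x∉A)

    match-∈ : ∀ {x} (x∈L : x ∈ L) → match x∈L ∈ R
    match-∈ {x} x∈L with x ∈? A
    ... | yes x∈A = proj₂ (x∈p∩q⁻ Q R (M₁.match-∈ x∈A))
    ... | no  x∉A = p─q⊆p R Q (M₂.match-∈ _)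

    match-edge : ∀ {x} (x∈L : x ∈ L) → E x (match x∈L)
    match-edge {x} x∈L with x ∈? A
    ... | yes x∈A = M₁.match-edge x∈A
    ... | no  x∉A = M₂.match-edge _

    in-Q : ∀ {x y} (x∈A : x ∈ A) (y∈L─A : y ∈ L ─ A) → M₁.match x∈A ≢ M₂.match y∈L─A
    in-Q x∈A y∈L─A eq = x∈p─q⇒x∉q (M₂.match-∈ y∈L─A) (subst (_∈ Q) eq (proj₁ (x∈p∩q⁻ Q R (M₁.match-∈ x∈A))))

    match-injective : ∀ {x y} (x∈L : x ∈ L) (y∈L : y ∈ L) → match x∈L ≡ match y∈L → x ≡ y
    match-injective {x} {y} x∈L y∈L with x ∈? A | y ∈? A
    ... | yes x∈A | yes y∈A = M₁.match-injective x∈A y∈A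
    ... | yes x∈A | no  _   = λ eq → contradiction eq (in-Q x∈A _)
    ... | no  _   | yes y∈A = λ eq → contradiction (sym eq) (in-Q y∈A _)
    ... | no  _   | no  _   = M₂.match-injective _ _

  hall-restrict : ∀ {L R A} → HallCondition L R → A ⊆ L → HallCondition A (N A ∩ R)
  hall-restrict {R = R} {A} hall A⊆L {C} C⊆A = ≤-trans (hall (⊆-trans C⊆A A⊆L)) (p⊆q⇒∣p∣≤∣q∣ NC∩R⊆)
    where
    NC∩R⊆ : N C ∩ R ⊆ N C ∩ (N A ∩ R)
    NC∩R⊆ y∈ with y∈NC , y∈R ← x∈p∩q⁻ (N C) R y∈ =
      x∈p∩q⁺ (y∈NC , x∈p∩q⁺ (neighbours-mono E? C⊆A y∈NC , y∈R))

  hall-contract : ∀ {L R A} → HallCondition L R → A ⊆ L → ∣ N A ∩ R ∣ ≤ ∣ A ∣ →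
                  HallCondition (L ─ A) (R ─ N A)
  hall-contract {L} {R} {A} hall A⊆L tight {C} C⊆L─A = +-cancelʳ-≤ (∣ A ∣) (∣ C ∣) (∣ X ∣) (begin
    ∣ C ∣ + ∣ A ∣       ≡⟨ sym (disjoint⇒∣p∪q∣≡∣p∣+∣q∣ C A C∩A=∅) ⟩
    ∣ C ∪ A ∣           ≤⟨ hall C∪A⊆L ⟩
    ∣ N (C ∪ A) ∩ R ∣   ≤⟨ p⊆q⇒∣p∣≤∣q∣ cover ⟩
    ∣ X ∪ Y ∣           ≤⟨ ∣p∪q∣≤∣p∣+∣q∣ X Y ⟩
    ∣ X ∣ + ∣ Y ∣       ≤⟨ +-monoʳ-≤ (∣ X ∣) tight ⟩
    ∣ X ∣ + ∣ A ∣       ∎)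
    where
    open ≤-Reasoning
    X Y : Subset l
    X = N C ∩ (R ─ N A)
    Y = N A ∩ R

    C∩A=∅ : Empty (C ∩ A)
    C∩A=∅ (x , x∈C∩A) with x∈C , x∈A ← x∈p∩q⁻ C A x∈C∩A = x∈p─q⇒x∉q (C⊆L─A x∈C) x∈A

    C∪A⊆L : C ∪ A ⊆ L
    C∪A⊆L x∈ with x∈p∪q⁻ C A x∈
    ... | inj₁ x∈C = p─q⊆p L A (C⊆L─A x∈C)
    ... | inj₂ x∈A = A⊆L x∈A

    cover : N (C ∪ A) ∩ R ⊆ X ∪ Y
    cover {y} y∈ with y∈N , y∈R ← x∈p∩q⁻ (N (C ∪ A)) R y∈ | y ∈? N A
    ... | yes y∈NA = x∈p∪q⁺ (inj₂ (x∈p∩q⁺ (y∈NA , y∈R)))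
    ... | no  y∉NA with x∈p∪q⁻ (N C) (N A) (neighbours-∪ E? C A y∈N)
    ...   | inj₁ y∈NC = x∈p∪q⁺ (inj₁ (x∈p∩q⁺ (y∈NC , x∈p∧x∉q⇒x∈p─q y∈R y∉NA)))
    ...   | inj₂ y∈NA = contradiction y∈NA y∉NA

  hall-remove : ∀ {L R x y} → (∀ {C} → Nonempty C → C ⊂ L → ∣ C ∣ < ∣ N C ∩ R ∣) → x ∈ L →
                HallCondition (L - x) (R - y)
  hall-remove {L} {R} {x} {y} surplus x∈L {C} C⊆L-x with nonempty? C
  ... | no  C=∅ = subst (_≤ ∣ N C ∩ (R - y) ∣) (sym (Empty⇒∣p∣≡0 C=∅)) z≤n
  ... | yes C≠∅ = +-cancelʳ-≤ 1 (∣ C ∣) (∣ X ∣) (begin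
    ∣ C ∣ + 1          ≡⟨ +-comm (∣ C ∣) 1 ⟩
    suc ∣ C ∣          ≤⟨ surplus C≠∅ (⊆-⊂-trans C⊆L-x (x∈p⇒p-x⊂p x∈L)) ⟩
    ∣ N C ∩ R ∣        ≤⟨ p⊆q⇒∣p∣≤∣q∣ cover ⟩
    ∣ X ∪ ⁅ y ⁆ ∣      ≤⟨ ∣p∪q∣≤∣p∣+∣q∣ X ⁅ y ⁆ ⟩
    ∣ X ∣ + ∣ ⁅ y ⁆ ∣  ≡⟨ cong (∣ X ∣ +_) (∣⁅x⁆∣≡1 y) ⟩
    ∣ X ∣ + 1          ∎)
    where
    open ≤-Reasoning
    X : Subset l
    X = N C ∩ (R - y)

    cover : N C ∩ R ⊆ X ∪ ⁅ y ⁆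
    cover {z} z∈ with z ≟ y
    ... | yes refl = x∈p∪q⁺ (inj₂ (x∈⁅x⁆ y))
    ... | no  z≢y  with z∈NC , z∈R ← x∈p∩q⁻ (N C) R z∈ =
      x∈p∪q⁺ (inj₁ (x∈p∩q⁺ (z∈NC , x∈p∧x≢y⇒x∈p-y z∈R z≢y)))

  hall-edge : ∀ {L R x} → HallCondition L R → x ∈ L → ∃ λ y → y ∈ R × E x y
  hall-edge {L} {R} {x} hall x∈L
    with y , y∈ ← 0<∣p∣⇒Nonempty (subst (_≤ ∣ N ⁅ x ⁆ ∩ R ∣) (∣⁅x⁆∣≡1 x) (hall (x∈p⇒⁅x⁆⊆p x∈L)))
    with y∈N⁅x⁆ , y∈R ← x∈p∩q⁻ (N ⁅ x ⁆) R y∈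
    with x′ , x′∈⁅x⁆ , e ← ∈-neighbours⁻ E? y∈N⁅x⁆
    = y , y∈R , subst (λ x′ → E x′ y) (x∈⁅y⁆⇒x≡y x x′∈⁅x⁆) e

  -- Halmos–Vaughan: split along a tight proper subset if there is one, otherwise match one
  -- vertex arbitrarily; both recursive calls are on proper subsets of L.
  hall-acc : ∀ {L} → Acc _⊂_ L → ∀ R → HallCondition L R → Matching L R
  hall-acc {L} (acc smaller) R hall
    with anySubset? (λ A → nonempty? A ×-dec A ⊂? L ×-dec ∣ N A ∩ R ∣ ≤? ∣ A ∣)
  ... | yes (A , (x , x∈A) , A⊂L , tight) =
    split-matching A⊆L (hall-acc (smaller A⊂L) _ (hall-restrict hall A⊆L))
                       (hall-acc (smaller L─A⊂L) _ (hall-contract hall A⊆L tight))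
    where
    A⊆L : A ⊆ L
    A⊆L = p⊂q⇒p⊆q A⊂L

    L─A⊂L : L ─ A ⊂ L
    L─A⊂L = p∩q≢∅⇒p─q⊂p L A (x , x∈p∩q⁺ (A⊆L x∈A , x∈A))
  ... | no no-tight-set with nonempty? L
  ...   | no  L=∅       = empty-matching L=∅
  ...   | yes (x , x∈L) with y , y∈R , e ← hall-edge hall x∈L =
    split-matching (x∈p⇒⁅x⁆⊆p x∈L) (singleton-matching y∈R e) (hall-acc (smaller (x∈p⇒p-x⊂p x∈L)) _ (hall-remove surplus x∈L))
    where
    surplus : ∀ {C} → Nonempty C → C ⊂ L → ∣ C ∣ < ∣ N C ∩ R ∣
    surplus C≠∅ C⊂L = ≰⇒> (λ tight → no-tight-set (_ , C≠∅ , C⊂L , tight))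

  hall : ∀ {L R} → HallCondition L R → Matching L R
  hall {L} {R} = hall-acc (⊂-wellFounded L) R

module _ {m n} (P : Fin n → Fin m → Bool) where

  inverse-of-el : ∀ {y i l} → IsInverseOf (mul P) y (el i l) →
                  ∃₂ λ j μ → y ≡ el j μ × P l j ≡ true × P μ i ≡ true
  inverse-of-el {el j μ} {i} {l} (eq , _) with P l j in Plj
  ... | false = contradiction eq λ ()
  ... | true with P μ i in Pμi
  ...   | false = contradiction eq λ ()
  ...   | true  = j , μ , refl , Plj , Pμi

  el-inverse : ∀ {i l j μ} → P l j ≡ true → P μ i ≡ true → IsInverseOf (mul P) (el j μ) (el i l)
  el-inverse Plj Pμi rewrite Plj | Pμi | Plj = refl , refl

  meets? : ∀ i μ → Dec (P μ i ≡ true)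
  meets? i μ = P μ i Bool.≟ true

  ∣I∣*n≤m*∣neighbours∣ : (f : ZRB m n → ZRB m n) → Injective _≡_ _≡_ f → (∀ x → IsInverseOf (mul P) (f x) x) →
                         ∀ I → ∣ I ∣ * n ≤ m * ∣ neighbours meets? I ∣
  ∣I∣*n≤m*∣neighbours∣ f f-inj f-inv I = begin
    ∣ I ∣ * n                                    ≡⟨ sym (cong₂ _*_ (length-elements I) (length-allFin n)) ⟩
    length (elements I) * length (allFin n)      ≡⟨ sym (length-cartesianProduct (elements I) (allFin n)) ⟩
    length sources                               ≤⟨ injective-map⇒length≤ (f ∘ uncurry el) f∘el-injective sources-unique ∈-targets ⟩
    length (map (uncurry el) targets)            ≡⟨ length-map (uncurry el) targets ⟩
    length targets                               ≡⟨ length-cartesianProduct (allFin m) (elements Γ) ⟩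
    length (allFin m) * length (elements Γ)      ≡⟨ cong₂ _*_ (length-allFin m) (length-elements Γ) ⟩
    m * ∣ Γ ∣                                     ∎
    where
    open ≤-Reasoning
    Γ : Subset n
    Γ = neighbours meets? I

    sources targets : List (Fin m × Fin n)
    sources = cartesianProduct (elements I) (allFin n)
    targets = cartesianProduct (allFin m) (elements Γ)

    sources-unique : Unique sources
    sources-unique = Unique.cartesianProduct⁺ (elements-unique I) (Unique.allFin⁺ n)

    f∘el-injective : ∀ {p q} → f (uncurry el p) ≡ f (uncurry el q) → p ≡ q
    f∘el-injective {_ , _} {_ , _} eq with refl ← f-inj eq = refl

    ∈-targets : ∀ {p} → p ∈ₗ sources → f (uncurry el p) ∈ₗ map (uncurry el) targets
    ∈-targets {i , l} p∈ with j , μ , fp≡el , _ , μ-meets ← inverse-of-el (f-inv (el i l)) =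
      subst (_∈ₗ map (uncurry el) targets) (sym fp≡el)
        (∈-map⁺ (uncurry el) (∈-cartesianProduct⁺ (∈-allFin j)
          (∈-elements⁺ (∈-neighbours⁺ meets? (∈-elements⁻ I (proj₁ (∈-cartesianProduct⁻ _ _ p∈))) μ-meets))))

module _ {K : Set} {m n} (P : Fin n → Fin m → Bool) (σ : (K × Fin m) ↔ Fin n) where
  open Inverse σ

  swap : ZRB m n → ZRB m n
  swap 𝟎        = 𝟎
  swap (el i μ) = el (proj₂ (from μ)) (to (proj₁ (from μ) , i))

  swap-involutive : ∀ x → swap (swap x) ≡ x
  swap-involutive 𝟎        = refl
  swap-involutive (el i μ) = begin
    swap (swap (el i μ))  ≡⟨ cong (λ (d , k) → el k (to (d , proj₂ (from μ)))) (strictlyInverseʳ (proj₁ (from μ) , i)) ⟩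
    el i (to (from μ))    ≡⟨ cong (el i) (strictlyInverseˡ μ) ⟩
    el i μ                ∎
    where open ≡-Reasoning

  swap-inverse : (∀ c i → P (to (c , i)) i ≡ true) → ∀ x → IsInverseOf (mul P) (swap x) x
  swap-inverse meets 𝟎        = refl , refl
  swap-inverse meets (el i μ) = el-inverse P μ-meets (meets c i)
    where
    c : K
    c = proj₁ (from μ)

    j : Fin m
    j = proj₂ (from μ)

    μ-meets : P μ j ≡ true
    μ-meets = subst (λ ν → P ν j ≡ true) (strictlyInverseˡ μ) (meets c j)

  involution-matching : (∀ c i → P (to (c , i)) i ≡ true) → InvolutionMatching (mul P)
  involution-matching meets = swap , swap-involutive , swap-inverse meets

-- Column l is the slot (c , i) = remQuot m l, reserved for row i; each row gets a slots.
module Blocks (a m : ℕ) where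

  row : Fin (a * m) → Fin m
  row l = proj₂ (remQuot {a} m l)

  row? : ∀ l i → Dec (row l ≡ i)
  row? l i = row l ≟ i

  rows : Subset (a * m) → Subset m
  rows = neighbours row?

  ∣A∣≤a*∣rows∣ : ∀ A → ∣ A ∣ ≤ a * ∣ rows A ∣
  ∣A∣≤a*∣rows∣ A = begin
    ∣ A ∣                                                    ≡⟨ sym (length-elements A) ⟩
    length (elements A)                                      ≤⟨ injective-map⇒length≤ (remQuot m) remQuot-injective (elements-unique A) ∈-blocks ⟩
    length (cartesianProduct (allFin a) (elements (rows A))) ≡⟨ length-cartesianProduct (allFin a) (elements (rows A)) ⟩
    length (allFin a) * length (elements (rows A))           ≡⟨ cong₂ _*_ (length-allFin a) (length-elements (rows A)) ⟩
    a * ∣ rows A ∣                                            ∎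
    where
    open ≤-Reasoning

    remQuot-injective : ∀ {l l′} → remQuot {a} m l ≡ remQuot m l′ → l ≡ l′
    remQuot-injective {l} {l′} eq =
      trans (sym (combine-remQuot {a} m l)) (trans (cong (uncurry combine) eq) (combine-remQuot {a} m l′))

    ∈-blocks : ∀ {l} → l ∈ₗ elements A → remQuot m l ∈ₗ cartesianProduct (allFin a) (elements (rows A))
    ∈-blocks {l} l∈ = ∈-cartesianProduct⁺ (∈-allFin _) (∈-elements⁺ (∈-neighbours⁺ row? (∈-elements⁻ A l∈) refl))

module _ {a m} .{{_ : NonZero m}} (P : Fin (a * m) → Fin m → Bool) where

  open Blocks a m

  slot? : ∀ l μ → Dec (P μ (row l) ≡ true)
  slot? l μ = meets? P (row l) μ

  open Hall slot?

  hall-condition : (f : ZRB m (a * m) → ZRB m (a * m)) → Injective _≡_ _≡_ f →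
                   (∀ x → IsInverseOf (mul P) (f x) x) → HallCondition ⊤ ⊤
  hall-condition f f-inj f-inv {A} _ = begin
    ∣ A ∣                        ≤⟨ ∣A∣≤a*∣rows∣ A ⟩
    a * ∣ rows A ∣               ≤⟨ *-cancelʳ-≤ (a * ∣ rows A ∣) ∣Γ∣ m a*r*m≤∣Γ∣*m ⟩
    ∣Γ∣                          ≤⟨ p⊆q⇒∣p∣≤∣q∣ (neighbours-∘ row? (meets? P) slot? (λ { refl μ-meets → μ-meets }) A) ⟩
    ∣ neighbours slot? A ∣       ≡⟨ cong ∣_∣ (sym (∩-identityʳ (neighbours slot? A))) ⟩
    ∣ neighbours slot? A ∩ ⊤ ∣   ∎
    where
    open ≤-Reasoning
    ∣Γ∣ : ℕ
    ∣Γ∣ = ∣ neighbours (meets? P) (rows A) ∣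

    a*r*m≤∣Γ∣*m : a * ∣ rows A ∣ * m ≤ ∣Γ∣ * m
    a*r*m≤∣Γ∣*m = begin
      a * ∣ rows A ∣ * m      ≡⟨ cong (_* m) (*-comm a (∣ rows A ∣)) ⟩
      ∣ rows A ∣ * a * m      ≡⟨ *-assoc (∣ rows A ∣) a m ⟩
      ∣ rows A ∣ * (a * m)    ≤⟨ ∣I∣*n≤m*∣neighbours∣ P f f-inj f-inv (rows A) ⟩
      m * ∣Γ∣                 ≡⟨ *-comm m ∣Γ∣ ⟩
      ∣Γ∣ * m                 ∎

  slots↔columns : PermutationMatching (mul P) →
                  Σ ((Fin a × Fin m) ↔ Fin (a * m)) λ σ → ∀ c i → P (Inverse.to σ (c , i)) i ≡ true
  slots↔columns (f , (f-inj , _) , f-inv) = g↔ ↔-∘ ↔-sym *↔× , meets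
    where
    open Matching (hall (hall-condition f f-inj f-inv))
    g : Fin (a * m) → Fin (a * m)
    g l = match (∈⊤ {x = l})
    g↔ : Fin (a * m) ↔ Fin (a * m)
    g↔ = Fin-injective⇒↔ {f = g} (match-injective ∈⊤ ∈⊤)
    meets : ∀ c i → P (g (combine c i)) i ≡ true
    meets c i = subst (λ j → P (g (combine c i)) j ≡ true) (cong proj₂ (remQuot-combine {a} c i)) (match-edge ∈⊤)

proposition2p3 : (m n a : ℕ) → 0 < m → 0 < a → n ≡ a * m →
    (P : Fin n → Fin m → Bool) → RegularMatrix P →
    PermutationMatching (mul P) → InvolutionMatching (mul P)
proposition2p3 (suc m) _ a _ _ refl P _ pm = uncurry (involution-matching P) (slots↔columns {a} P pm)
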